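{- Let $\mathcal{H}'$ be an intersecting $6$-partite hypergraph with exactly $8$ edges and $\tau(\mathcal{H}') = 4$. Then every part of $\mathcal{H}'$ contains a vertex of degree $3$, and there exist two distinct edges of $\mathcal{H}'$ which have at least two vertices of degree $3$ in common.
   Context: A hypergraph consists of a vertex set and a set of edges, each a nonempty subset of the vertex set. It is $6$-partite if its vertex set can be partitioned into $6$ parts such that every edge contains exactly one vertex from each part (the parts are called partitions). It is intersecting if every two edges share at least one vertex. $\tau$ denotes the minimum size of a set of vertices meeting every edge. The degree of a vertex $v$ is the number of edges containing $v$. -}

module Defs where

open import Data.Nat using (ℕ; _≤_)
open import Data.Nat.Properties using (_≟_)
open import Data.Fin using (Fin)
open import Data.List using (List; length; filter; allFin)
open import Data.List.Relation.Unary.Any using (Any)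
open import Data.Product using (_×_; _,_; proj₁; proj₂; ∃; ∃-syntax)
open import Relation.Binary.PropositionalEquality using (_≡_; _≢_)
open import Relation.Nullary using (¬_)

-- Vertices are pairs (i , x): part i : Fin 6, label x : ℕ.  Parts are thus
-- disjoint by construction.  An edge contains exactly one vertex per part,
-- so it is given by a function Fin 6 → ℕ (its vertex in part i is (i , e i)).
Vertex : Set
Vertex = Fin 6 × ℕ

Edge : Set
Edge = Fin 6 → ℕ

_∈ₑ_ : Vertex → Edge → Set
v ∈ₑ e = e (proj₁ v) ≡ proj₂ v

-- A hypergraph with m edges; edges form a set, so they are pairwise distinct.
record Hypergraph6 (m : ℕ) : Set where
  field
    edge     : Fin m → Edge
    distinct : ∀ j k → j ≢ k → ¬ (∀ i → edge j i ≡ edge k i)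
open Hypergraph6 public

Intersecting : ∀ {m} → Hypergraph6 m → Set
Intersecting H = ∀ j k → ∃[ v ] (v ∈ₑ edge H j × v ∈ₑ edge H k)

degree : ∀ {m} → Hypergraph6 m → Vertex → ℕ
degree {m} H (i , x) = length (filter (λ j → edge H j i ≟ x) (allFin m))

IsCover : ∀ {m} → Hypergraph6 m → List Vertex → Set
IsCover H C = ∀ j → Any (λ v → v ∈ₑ edge H j) C

-- τ(H) = t : there is a cover with t vertices, and no cover with fewer
-- (a list of length < t, repetitions allowed, which covers sets of size < t)
TauEq : ∀ {m} → Hypergraph6 m → ℕ → Set
TauEq H t = (∃[ C ] (length C ≡ t × IsCover H C))
          × (∀ C → IsCover H C → t ≤ length C)

module Submission where

-- In an intersecting hypergraph the edges missed by a vertex list C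
--     can be covered two at a time, so C misses at least 2(τ - |C|) - 1 edges.
--     For 8 edges and τ = 4: all degrees are at most 3, and any two vertices
--     of degree 3 ("heavy" vertices) lie on a common edge.
-- (2) Counting (module Core).  A part has at most one heavy vertex, and if it
--     has one it also has a vertex of degree 1 (parity).  Counting the
--     incidences of an edge j in two ways gives
--     closeCount j + lightOn j ≤ heavyOn j.  With K parts containing a heavy
--     vertex, Σ heavyOn = 3K and Σ heavyOn² ≥ K(K + 2).
-- (3) If no two heavy vertices shared two edges, every edge would carry at most
--     two heavy vertices and K² - 7K + 16 ≤ 0 would follow; so some two do.
-- (4) If a part had no heavy vertex, (2) and (3) would force K = 5, make all
--     counts tight, bound heavyOn by 3 and give 37 ≤ Σ heavyOn² ≤ 36.

open import Defs
open import Data.Nat using (ℕ; zero; suc; _+_; _*_; _≤_; _<_; z≤n; s≤s; _≤?_)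
open import Data.Nat.Properties
open import Data.Nat.Tactic.RingSolver using (solve-∀)
open import Data.Fin using (Fin; zero; suc; punchIn; punchOut)
import Data.Fin.Properties as Fin
open import Data.Vec.Functional using (removeAt)
open import Data.Product using (_×_; _,_; proj₁; proj₂; ∃-syntax)
open import Data.Empty using (⊥; ⊥-elim)
open import Data.Sum using (_⊎_; inj₁; inj₂)
open import Function using (_∘_; id)
open import Data.List using (List; []; _∷_; [_]; length; filter; tabulate; allFin; _++_)
open import Data.List.Properties using (length-++)
open import Data.List.Relation.Unary.Any using (Any; here; there; any?)
open import Data.List.Relation.Unary.Any.Properties using (++⁺ˡ; ++⁺ʳ)
open import Data.List.Membership.Propositional using (_∈_)
open import Data.List.Membership.Propositional.Properties using (∈-filter⁺; ∈-allFin)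
open import Relation.Unary using (Decidable)
open import Relation.Nullary using (¬_; Dec; yes; no; contradiction; ¬?)
open import Relation.Nullary.Decidable using (from-yes; from-no; _×-dec_; decidable-stable)
open import Relation.Binary.PropositionalEquality
  using (_≡_; _≢_; refl; sym; trans; cong; cong₂; subst; subst₂; module ≡-Reasoning)

open import Algebra.Properties.Semiring.Sum +-*-semiring
  using (sum; ∑-distrib-+; ∑-comm; *-distribˡ-sum; *-distribʳ-sum; sum-remove; sum-cong-≗)

sum-const : ∀ {n} (c : ℕ) → sum {n} (λ _ → c) ≡ n * c
sum-const {zero}  c = refl
sum-const {suc n} c = cong (c +_) (sum-const {n} c)

sum-zero : ∀ {n} → sum {n} (λ _ → 0) ≡ 0
sum-zero {n} = trans (sum-const {n} 0) (*-zeroʳ n)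

sum-mono : ∀ {n} {f g : Fin n → ℕ} → (∀ k → f k ≤ g k) → sum f ≤ sum g
sum-mono {zero}  f≤g = z≤n
sum-mono {suc n} f≤g = +-mono-≤ (f≤g zero) (sum-mono (f≤g ∘ suc))

sum-bump : ∀ {n} {f g : Fin n → ℕ} (a : Fin n) {c : ℕ} →
           (∀ k → f k ≤ g k) → c + f a ≤ g a → c + sum f ≤ sum g
sum-bump {suc n} {f} {g} a {c} f≤g gain = begin
  c + sum f                         ≡⟨ cong (c +_) (sum-remove f) ⟩
  c + (f a + sum (removeAt f a))    ≡⟨ +-assoc c (f a) _ ⟨
  c + f a + sum (removeAt f a)      ≤⟨ +-mono-≤ gain (sum-mono (f≤g ∘ punchIn a)) ⟩
  g a + sum (removeAt g a)          ≡⟨ sum-remove g ⟨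
  sum g                             ∎
  where open ≤-Reasoning

sum-bump₂ : ∀ {n} {f g : Fin n → ℕ} {a b : Fin n} {c d : ℕ} → a ≢ b →
            (∀ k → f k ≤ g k) → c + f a ≤ g a → d + f b ≤ g b → c + d + sum f ≤ sum g
sum-bump₂ {suc n} {f} {g} {a} {b} {c} {d} a≢b f≤g gain-a gain-b = begin
  c + d + sum f                      ≡⟨ cong (c + d +_) (sum-remove f) ⟩
  c + d + (f a + sum (removeAt f a)) ≡⟨ swap c d (f a) _ ⟩
  (c + f a) + (d + sum (removeAt f a)) ≤⟨ +-mono-≤ gain-a (sum-bump (punchOut a≢b) (f≤g ∘ punchIn a) gain-b′) ⟩
  g a + sum (removeAt g a)           ≡⟨ sum-remove g ⟨
  sum g                              ∎
  where
  open ≤-Reasoning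
  swap : ∀ c d x y → c + d + (x + y) ≡ (c + x) + (d + y)
  swap = solve-∀
  gain-b′ : d + removeAt f a (punchOut a≢b) ≤ removeAt g a (punchOut a≢b)
  gain-b′ rewrite Fin.punchIn-punchOut a≢b = gain-b

sum-point : ∀ {n} (f : Fin n → ℕ) (a : Fin n) → f a ≤ sum f
sum-point {suc n} f a = ≤-trans (m≤m+n (f a) _) (≤-reflexive (sym (sum-remove f)))

sum-two : ∀ {n} (f : Fin n → ℕ) {a b : Fin n} → a ≢ b → f a + f b ≤ sum f
sum-two {n} f {a} {b} a≢b =
  subst (_≤ sum f) (trans (cong (f a + f b +_) (sum-zero {n})) (+-identityʳ _))
    (sum-bump₂ a≢b (λ _ → z≤n) (≤-reflexive (+-identityʳ (f a))) (≤-reflexive (+-identityʳ (f b))))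

sum-tight : ∀ {n} {f g : Fin n → ℕ} → (∀ k → f k ≤ g k) → sum g ≤ sum f → ∀ k → g k ≤ f k
sum-tight {f = f} {g} f≤g Σg≤Σf k with g k ≤? f k
... | yes gk≤fk = gk≤fk
... | no  gk≰fk = contradiction Σg≤Σf (<⇒≱ (sum-bump k f≤g (≰⇒> gk≰fk)))

sum-witness : ∀ {n} (f : Fin n → ℕ) → 1 ≤ sum f → ∃[ a ] 1 ≤ f a
sum-witness {n} f 1≤Σf with Fin.any? (λ a → 1 ≤? f a)
... | yes found = found
... | no  none  = contradiction (≤-trans 1≤Σf (≤-trans (sum-mono zero-term) (≤-reflexive (sum-zero {n})))) λ ()
  where
  zero-term : ∀ a → f a ≤ 0
  zero-term a = ≤-pred (≰⇒> (λ 1≤fa → none (a , 1≤fa)))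

sum-witness₂ : ∀ {n} (f : Fin n → ℕ) → (∀ k → f k ≤ 1) → 2 ≤ sum f →
               ∃[ a ] ∃[ b ] (a ≢ b × 1 ≤ f a × 1 ≤ f b)
sum-witness₂ {zero}  f f≤1 ()
sum-witness₂ {suc n} f f≤1 2≤Σf with sum-witness f (≤-trans (s≤s z≤n) 2≤Σf)
... | a , 1≤fa with sum-witness (removeAt f a) rest-positive
  where
  rest-positive : 1 ≤ sum (removeAt f a)
  rest-positive = +-cancelˡ-≤ 1 1 _ (≤-trans 2≤Σf (≤-trans (≤-reflexive (sum-remove f))
                    (+-monoˡ-≤ _ (f≤1 a))))
...   | b , 1≤fb = a , punchIn a b , Fin.punchInᵢ≢i a b ∘ sym , 1≤fa , 1≤fb

above-diagonal : ∀ {n} → (Fin n → Fin n → ℕ) → ℕ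
above-diagonal {zero}  g = 0
above-diagonal {suc n} g = sum (λ k → g zero (suc k)) + above-diagonal (λ j k → g (suc j) (suc k))

sum-symmetric : ∀ {n} (g : Fin n → Fin n → ℕ) → (∀ j k → g j k ≡ g k j) →
                sum (λ j → sum (g j)) ≡ sum (λ j → g j j) + 2 * above-diagonal g
sum-symmetric {zero}  g g-sym = refl
sum-symmetric {suc n} g g-sym = begin
  (g₀₀ + R) + sum (λ j → g (suc j) zero + sum (λ k → g (suc j) (suc k)))
    ≡⟨ cong ((g₀₀ + R) +_) (∑-distrib-+ (λ j → g (suc j) zero) (λ j → sum (g (suc j) ∘ suc))) ⟩
  (g₀₀ + R) + (sum (λ j → g (suc j) zero) + S)
    ≡⟨ cong (λ C → (g₀₀ + R) + (C + S)) (sum-cong-≗ (λ j → g-sym (suc j) zero)) ⟩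
  (g₀₀ + R) + (R + S)
    ≡⟨ cong (λ X → (g₀₀ + R) + (R + X)) (sum-symmetric (λ j k → g (suc j) (suc k)) (λ j k → g-sym (suc j) (suc k))) ⟩
  (g₀₀ + R) + (R + (D + 2 * U))
    ≡⟨ regroup g₀₀ R D U ⟩
  (g₀₀ + D) + 2 * (R + U)
    ∎
  where
  open ≡-Reasoning
  g₀₀ = g zero zero
  R = sum (λ k → g zero (suc k))
  S = sum (λ j → sum (g (suc j) ∘ suc))
  D = sum (λ j → g (suc j) (suc j))
  U = above-diagonal (λ j k → g (suc j) (suc k))
  regroup : ∀ a r d u → (a + r) + (r + (d + 2 * u)) ≡ (a + d) + 2 * (r + u)
  regroup = solve-∀

𝟙 : ∀ {p} {P : Set p} → Dec P → ℕ
𝟙 (yes _) = 1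
𝟙 (no  _) = 0

module _ {p} {P : Set p} where

  𝟙≤1 : (P? : Dec P) → 𝟙 P? ≤ 1
  𝟙≤1 (yes _) = s≤s z≤n
  𝟙≤1 (no  _) = z≤n

  𝟙-yes : (P? : Dec P) → P → 𝟙 P? ≡ 1
  𝟙-yes (yes _) _  = refl
  𝟙-yes (no ¬p) p  = contradiction p ¬p

  𝟙-no : (P? : Dec P) → ¬ P → 𝟙 P? ≡ 0
  𝟙-no (yes p) ¬p = contradiction p ¬p
  𝟙-no (no  _) _  = refl

  𝟙-sound : (P? : Dec P) → 1 ≤ 𝟙 P? → P
  𝟙-sound (yes p) _ = p

  𝟙-idem : (P? : Dec P) → 𝟙 P? * 𝟙 P? ≡ 𝟙 P?
  𝟙-idem (yes _) = refl
  𝟙-idem (no  _) = refl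

  𝟙-¬ : (P? : Dec P) → 𝟙 (¬? P?) + 𝟙 P? ≡ 1
  𝟙-¬ (yes _) = refl
  𝟙-¬ (no  _) = refl

𝟙-both : ∀ {p q} {P : Set p} {Q : Set q} (P? : Dec P) (Q? : Dec Q) → 1 ≤ 𝟙 P? * 𝟙 Q? → P × Q
𝟙-both (yes p) (yes q) _ = p , q

𝟙-both-yes : ∀ {p q} {P : Set p} {Q : Set q} (P? : Dec P) (Q? : Dec Q) → P → Q → 𝟙 P? * 𝟙 Q? ≡ 1
𝟙-both-yes P? Q? p q = cong₂ _*_ (𝟙-yes P? p) (𝟙-yes Q? q)

𝟙-cong : ∀ {p q} {P : Set p} {Q : Set q} (P? : Dec P) (Q? : Dec Q) → (P → Q) → (Q → P) → 𝟙 P? ≡ 𝟙 Q?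
𝟙-cong (yes _) (yes _) _ _ = refl
𝟙-cong (yes p) (no ¬q) f _ = contradiction (f p) ¬q
𝟙-cong (no ¬p) (yes q) _ g = contradiction (g q) ¬p
𝟙-cong (no  _) (no  _) _ _ = refl

𝟙-disjoint : ∀ {p q r} {P : Set p} {Q : Set q} {R : Set r} (P? : Dec P) (Q? : Dec Q) (R? : Dec R) →
             ¬ (P × Q) → (P → R) → (Q → R) → 𝟙 P? + 𝟙 Q? ≤ 𝟙 R?
𝟙-disjoint (yes p) (yes q) _       ¬pq _   _   = contradiction (p , q) ¬pq
𝟙-disjoint (yes p) (no  _) (no ¬r) _   p⇒r _   = contradiction (p⇒r p) ¬r
𝟙-disjoint (no  _) (yes q) (no ¬r) _   _   q⇒r = contradiction (q⇒r q) ¬r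
𝟙-disjoint (yes _) (no  _) (yes _) _   _   _   = s≤s z≤n
𝟙-disjoint (no  _) (yes _) (yes _) _   _   _   = s≤s z≤n
𝟙-disjoint (no  _) (no  _) _       _   _   _   = z≤n

sum-point-mass : ∀ {n} (a : Fin n) → sum (λ k → 𝟙 (k Fin.≟ a)) ≡ 1
sum-point-mass {suc n} a = begin
  sum (λ k → 𝟙 (k Fin.≟ a))                                ≡⟨ sum-remove (λ k → 𝟙 (k Fin.≟ a)) ⟩
  𝟙 (a Fin.≟ a) + sum (λ k → 𝟙 (punchIn a k Fin.≟ a))      ≡⟨ cong₂ _+_ (𝟙-yes (a Fin.≟ a) refl) elsewhere ⟩
  1                                                         ∎
  where
  open ≡-Reasoning
  elsewhere : sum (λ k → 𝟙 (punchIn a k Fin.≟ a)) ≡ 0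
  elsewhere = trans (sum-cong-≗ (λ k → 𝟙-no (punchIn a k Fin.≟ a) (Fin.punchInᵢ≢i a k))) (sum-zero {n})

length-filter-tabulate : ∀ {a p} {A : Set a} {P : A → Set p} (P? : Decidable P) {n} (f : Fin n → A) →
                         length (filter P? (tabulate f)) ≡ sum (λ k → 𝟙 (P? (f k)))
length-filter-tabulate P? {zero}  f = refl
length-filter-tabulate P? {suc n} f with P? (f zero)
... | yes _ = cong suc (length-filter-tabulate P? (f ∘ suc))
... | no  _ = length-filter-tabulate P? (f ∘ suc)

_∈?_ : (v : Vertex) (e : Edge) → Dec (v ∈ₑ e)
v ∈? e = e (proj₁ v) ≟ proj₂ v

module Covers {m} (H : Hypergraph6 m) where

  degree-sum : ∀ v → degree H v ≡ sum (λ k → 𝟙 (v ∈? edge H k))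
  degree-sum (i , x) = length-filter-tabulate (λ k → edge H k i ≟ x) id

  _covers?_ : (C : List Vertex) (k : Fin m) → Dec (Any (_∈ₑ edge H k) C)
  C covers? k = any? (_∈? edge H k) C

  covered uncovered : List Vertex → ℕ
  covered   C = sum (λ k → 𝟙 (C covers? k))
  uncovered C = sum (λ k → 𝟙 (¬? (C covers? k)))

  uncovered+covered : ∀ C → uncovered C + covered C ≡ m
  uncovered+covered C = begin
    uncovered C + covered C                              ≡⟨ ∑-distrib-+ (λ k → 𝟙 (¬? (C covers? k))) _ ⟨
    sum (λ k → 𝟙 (¬? (C covers? k)) + 𝟙 (C covers? k))   ≡⟨ sum-cong-≗ (λ k → 𝟙-¬ (C covers? k)) ⟩
    sum {m} (λ _ → 1)                                    ≡⟨ sum-const {m} 1 ⟩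
    m * 1                                                ≡⟨ *-identityʳ m ⟩
    m                                                    ∎
    where open ≡-Reasoning

  module _ (intersecting : Intersecting H) where

    -- In an intersecting hypergraph a list of L edges is covered by ⌈L/2⌉
    -- vertices: one common vertex for each consecutive pair.
    pairCover : List (Fin m) → List Vertex
    pairCover []               = []
    pairCover (j ∷ [])         = (zero , edge H j zero) ∷ []
    pairCover (j ∷ k ∷ rest)   = proj₁ (intersecting j k) ∷ pairCover rest

    pairCover-length : ∀ L → 2 * length (pairCover L) ≤ suc (length L)
    pairCover-length []             = z≤n
    pairCover-length (j ∷ [])       = s≤s (s≤s z≤n)
    pairCover-length (j ∷ k ∷ rest) =
      subst (_≤ 3 + length rest) (sym (*-distribˡ-+ 2 1 (length (pairCover rest))))
            (s≤s (s≤s (pairCover-length rest)))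

    pairCover-covers : ∀ L {k} → k ∈ L → Any (_∈ₑ edge H k) (pairCover L)
    pairCover-covers (j ∷ [])       (here refl)         = here refl
    pairCover-covers (j ∷ k ∷ rest) (here refl)         = here (proj₁ (proj₂ (intersecting j k)))
    pairCover-covers (j ∷ k ∷ rest) (there (here refl)) = here (proj₂ (proj₂ (intersecting j k)))
    pairCover-covers (j ∷ k ∷ rest) (there (there k∈)) = there (pairCover-covers rest k∈)

    -- If every cover has at least t vertices, then completing C by a pair cover
    -- of the missed edges shows that C misses at least 2(t - |C|) - 1 edges.
    uncovered-bound : ∀ {t} → (∀ C → IsCover H C → t ≤ length C) →
                      ∀ C → 2 * t ≤ 2 * length C + suc (uncovered C)
    uncovered-bound {t} τ≥t C = begin
      2 * t                               ≤⟨ *-monoʳ-≤ 2 (subst (t ≤_) (length-++ C) (τ≥t (C ++ P) completed)) ⟩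
      2 * (length C + length P)           ≡⟨ *-distribˡ-+ 2 (length C) (length P) ⟩
      2 * length C + 2 * length P         ≤⟨ +-monoʳ-≤ (2 * length C) (pairCover-length missed) ⟩
      2 * length C + suc (length missed)  ≡⟨ cong (λ u → 2 * length C + suc u) (length-filter-tabulate (λ k → ¬? (C covers? k)) id) ⟩
      2 * length C + suc (uncovered C)    ∎
      where
      open ≤-Reasoning
      missed = filter (λ k → ¬? (C covers? k)) (allFin m)
      P = pairCover missed
      completed : IsCover H (C ++ P)
      completed k with C covers? k
      ... | yes met = ++⁺ˡ met
      ... | no  ¬met = ++⁺ʳ C (pairCover-covers missed (∈-filter⁺ (λ k → ¬? (C covers? k)) (∈-allFin k) ¬met))

    -- A single vertex misses at least 2t - 3 edges, so its degree is at most m + 3 - 2t.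
    degree-bound : ∀ {t} → (∀ C → IsCover H C → t ≤ length C) → ∀ v → degree H v + 2 * t ≤ 3 + m
    degree-bound {t} τ≥t v = begin
      degree H v + 2 * t                 ≤⟨ +-monoʳ-≤ (degree H v) (uncovered-bound τ≥t [ v ]) ⟩
      degree H v + (2 + suc U)           ≡⟨ regroup (degree H v) U ⟩
      3 + (U + degree H v)               ≡⟨ cong (λ d → 3 + (U + d)) degree-covered ⟩
      3 + (U + covered [ v ])            ≡⟨ cong (3 +_) (uncovered+covered [ v ]) ⟩
      3 + m                              ∎
      where
      open ≤-Reasoning
      U = uncovered [ v ]
      regroup : ∀ d u → d + (2 + suc u) ≡ 3 + (u + d)
      regroup = solve-∀
      degree-covered : degree H v ≡ covered [ v ]
      degree-covered = trans (degree-sum v) (sum-cong-≗ (λ k →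
        𝟙-cong (v ∈? edge H k) ([ v ] covers? k) here (λ { (here v∈k) → v∈k })))

    -- Two vertices on no common edge miss at least 2t - 5 edges together.
    codegree-bound : ∀ {t} → (∀ C → IsCover H C → t ≤ length C) → ∀ v w →
                     (∀ k → ¬ (v ∈ₑ edge H k × w ∈ₑ edge H k)) →
                     degree H v + degree H w + 2 * t ≤ 5 + m
    codegree-bound {t} τ≥t v w apart = begin
      degree H v + degree H w + 2 * t    ≤⟨ +-mono-≤ degrees-covered (uncovered-bound τ≥t (v ∷ w ∷ [])) ⟩
      covered C + (4 + suc U)            ≡⟨ regroup (covered C) U ⟩
      5 + (U + covered C)                ≡⟨ cong (5 +_) (uncovered+covered C) ⟩
      5 + m                              ∎
      where
      open ≤-Reasoning
      C = v ∷ w ∷ []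
      U = uncovered C
      regroup : ∀ c u → c + (4 + suc u) ≡ 5 + (u + c)
      regroup = solve-∀
      degrees-covered : degree H v + degree H w ≤ covered C
      degrees-covered = begin
        degree H v + degree H w
          ≡⟨ cong₂ _+_ (degree-sum v) (degree-sum w) ⟩
        sum (λ k → 𝟙 (v ∈? edge H k)) + sum (λ k → 𝟙 (w ∈? edge H k))
          ≡⟨ ∑-distrib-+ (λ k → 𝟙 (v ∈? edge H k)) _ ⟨
        sum (λ k → 𝟙 (v ∈? edge H k) + 𝟙 (w ∈? edge H k))
          ≤⟨ sum-mono (λ k → 𝟙-disjoint (v ∈? edge H k) (w ∈? edge H k) (C covers? k)
                               (apart k) here (there ∘ here)) ⟩
        covered C ∎

between-1-and-3 : ∀ n → 1 ≤ n → n ≤ 3 → n + 𝟙 (n ≟ 1) ≡ 2 + 𝟙 (n ≟ 3)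
between-1-and-3 1 _ _ = refl
between-1-and-3 2 _ _ = refl
between-1-and-3 3 _ _ = refl
between-1-and-3 (suc (suc (suc (suc _)))) _ (s≤s (s≤s (s≤s ())))

three-or-one : ∀ n → 𝟙 (n ≟ 3) + 𝟙 (n ≟ 1) ≤ 1
three-or-one n with n ≟ 3 | n ≟ 1
... | yes refl | yes ()
... | yes _    | no  _ = s≤s z≤n
... | no  _    | yes _ = s≤s z≤n
... | no  _    | no  _ = z≤n

square-bound₂ : ∀ r → 1 ≤ r → r ≤ 2 → r * r + 2 ≤ 3 * r
square-bound₂ 1 _ _ = ≤-refl
square-bound₂ 2 _ _ = ≤-refl
square-bound₂ (suc (suc (suc _))) _ (s≤s (s≤s ()))

square-bound₃ : ∀ r → 1 ≤ r → r ≤ 3 → r * r + 3 ≤ 4 * r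
square-bound₃ 1 _ _ = ≤-refl
square-bound₃ 2 _ _ = from-yes (7 ≤? 8)
square-bound₃ 3 _ _ = ≤-refl
square-bound₃ (suc (suc (suc (suc _)))) _ (s≤s (s≤s (s≤s ())))

no-linear-count : ∀ k → k ≤ 6 → ¬ (k * (2 + k) + 16 ≤ 9 * k)
no-linear-count 0 _ = from-no (16 ≤? 0)
no-linear-count 1 _ = from-no (19 ≤? 9)
no-linear-count 2 _ = from-no (24 ≤? 18)
no-linear-count 3 _ = from-no (31 ≤? 27)
no-linear-count 4 _ = from-no (40 ≤? 36)
no-linear-count 5 _ = from-no (51 ≤? 45)
no-linear-count 6 _ = from-no (64 ≤? 54)
no-linear-count (suc (suc (suc (suc (suc (suc (suc _))))))) (s≤s (s≤s (s≤s (s≤s (s≤s (s≤s ()))))))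

forced-five : ∀ k z → k ≤ 5 → 10 + k + z ≤ 3 * k → k ≡ 5 × z ≡ 0
forced-five 5 z _ h = refl , n≤0⇒n≡0 (+-cancelˡ-≤ 15 z 0 h)
forced-five 0 z _ h = contradiction (≤-trans (m≤m+n 10 z) h) (from-no (10 ≤? 0))
forced-five 1 z _ h = contradiction (≤-trans (m≤m+n 11 z) h) (from-no (11 ≤? 3))
forced-five 2 z _ h = contradiction (≤-trans (m≤m+n 12 z) h) (from-no (12 ≤? 6))
forced-five 3 z _ h = contradiction (≤-trans (m≤m+n 13 z) h) (from-no (13 ≤? 9))
forced-five 4 z _ h = contradiction (≤-trans (m≤m+n 14 z) h) (from-no (14 ≤? 12))
forced-five (suc (suc (suc (suc (suc (suc _)))))) z (s≤s (s≤s (s≤s (s≤s (s≤s ()))))) h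

half-of-seven : ∀ r → 2 * r ≤ 7 → r ≤ 3
half-of-seven r h with r ≤? 3
... | yes r≤3 = r≤3
... | no  r≰3 = contradiction (≤-trans (*-monoʳ-≤ 2 (≰⇒> r≰3)) h) (from-no (8 ≤? 7))

module Core (H : Hypergraph6 8) (intersecting : Intersecting H)
            (degree≤3 : ∀ v → degree H v ≤ 3)
            (degree3-meet : ∀ v w → degree H v ≡ 3 → degree H w ≡ 3 → ∃[ k ] (v ∈ₑ edge H k × w ∈ₑ edge H k))
            where

  E : Fin 8 → Edge
  E = edge H

  agree : Fin 6 → Fin 8 → Fin 8 → ℕ
  agree i j k = 𝟙 ((i , E j i) ∈? E k)

  agree-self : ∀ i j → agree i j j ≡ 1
  agree-self i j = 𝟙-yes ((i , E j i) ∈? E j) refl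

  agree-sym : ∀ i j k → agree i j k ≡ agree i k j
  agree-sym i j k = 𝟙-cong ((i , E j i) ∈? E k) ((i , E k i) ∈? E j) sym sym

  -- Degree of the part-i vertex of edge j (kept opaque: only the lemmas below
  -- are used, which keeps the terms small).
  opaque
    deg : Fin 6 → Fin 8 → ℕ
    deg i j = sum (agree i j)

    deg-agree : ∀ i j → deg i j ≡ sum (agree i j)
    deg-agree i j = refl

    deg-degree : ∀ i j → degree H (i , E j i) ≡ deg i j
    deg-degree i j = Covers.degree-sum H (i , E j i)

    deg-pos : ∀ i j → 1 ≤ deg i j
    deg-pos i j = subst (_≤ deg i j) (agree-self i j) (sum-point (agree i j) j)

    deg-class : ∀ {i j k} → E k i ≡ E j i → deg i k ≡ deg i j
    deg-class {i} {j} {k} same = sum-cong-≗ (λ l →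
      𝟙-cong ((i , E k i) ∈? E l) ((i , E j i) ∈? E l) (λ e → trans e same) (λ e → trans e (sym same)))

  deg≤3 : ∀ i j → deg i j ≤ 3
  deg≤3 i j = subst (_≤ 3) (deg-degree i j) (degree≤3 (i , E j i))

  heavy-unique : ∀ {i j k} → deg i j ≡ 3 → deg i k ≡ 3 → E k i ≡ E j i
  heavy-unique {i} {j} {k} dj dk
    with degree3-meet (i , E j i) (i , E k i) (trans (deg-degree i j) dj) (trans (deg-degree i k) dk)
  ... | l , j∈l , k∈l = trans (sym k∈l) j∈l

  heavy light : Fin 6 → Fin 8 → ℕ
  heavy i j = 𝟙 (deg i j ≟ 3)
  light i j = 𝟙 (deg i j ≟ 1)

  deg-split : ∀ i j → deg i j + light i j ≡ 2 + heavy i j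
  deg-split i j = between-1-and-3 (deg i j) (deg-pos i j) (deg≤3 i j)

  heavy+light≤1 : ∀ i j → heavy i j + light i j ≤ 1
  heavy+light≤1 i j = three-or-one (deg i j)

  heavy-row : ∀ {i j} → deg i j ≡ 3 → ∀ k → heavy i k ≡ agree i j k
  heavy-row {i} {j} dj k with E k i ≟ E j i
  ... | yes same = 𝟙-yes (deg i k ≟ 3) (trans (deg-class same) dj)
  ... | no  diff = 𝟙-no (deg i k ≟ 3) (λ dk → diff (heavy-unique dj dk))

  heavyIn lightIn : Fin 6 → ℕ
  heavyIn i = sum (heavy i)
  lightIn i = sum (light i)

  heavyIn-3 : ∀ {i j} → deg i j ≡ 3 → heavyIn i ≡ 3
  heavyIn-3 {i} {j} dj = trans (sum-cong-≗ (heavy-row dj)) (trans (sym (deg-agree i j)) dj)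

  HasHeavy : Fin 6 → Set
  HasHeavy i = ∃[ j ] deg i j ≡ 3

  hasHeavy? : ∀ i → Dec (HasHeavy i)
  hasHeavy? i = Fin.any? (λ j → deg i j ≟ 3)

  hasHeavy : Fin 6 → ℕ
  hasHeavy i = 𝟙 (hasHeavy? i)

  heavyIn-hasHeavy : ∀ i → heavyIn i ≡ 3 * hasHeavy i
  heavyIn-hasHeavy i with hasHeavy? i
  ... | yes (j , dj) = heavyIn-3 dj
  ... | no  none     = trans (sum-cong-≗ (λ k → 𝟙-no (deg i k ≟ 3) (λ dk → none (k , dk)))) (sum-zero {8})

  heavy-weight : ∀ i j → heavy i j * heavyIn i ≡ 3 * heavy i j
  heavy-weight i j with deg i j ≟ 3
  ... | yes dj = trans (+-identityʳ (heavyIn i)) (heavyIn-3 dj)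
  ... | no  _  = refl

  degrees-in-part : ∀ i → sum (deg i) ≡ 8 + 2 * above-diagonal (agree i)
  degrees-in-part i = trans (sum-cong-≗ (deg-agree i)) (trans (sum-symmetric (agree i) (agree-sym i))
                            (cong (_+ 2 * above-diagonal (agree i)) (sum-cong-≗ (agree-self i))))

  degrees-split : ∀ i → sum (deg i) + lightIn i ≡ 16 + heavyIn i
  degrees-split i = trans (sym (∑-distrib-+ (deg i) (light i)))
                          (trans (sum-cong-≗ (deg-split i)) (∑-distrib-+ (λ _ → 2) (heavy i)))

  -- Without light vertex, a part with a heavy one would have odd degree sum 19.
  light-where-heavy : ∀ i → hasHeavy i ≤ lightIn i
  light-where-heavy i with hasHeavy? i
  ... | no  _        = z≤n
  ... | yes (j , dj) with lightIn i in no-light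
  ...   | suc _ = s≤s z≤n
  ...   | zero  = contradiction (+-cancelˡ-≡ 8 _ _ nineteen) (even≢odd (above-diagonal (agree i)) 5)
    where
    open ≡-Reasoning
    nineteen : 8 + 2 * above-diagonal (agree i) ≡ 8 + suc (2 * 5)
    nineteen = begin
      8 + 2 * above-diagonal (agree i)  ≡⟨ degrees-in-part i ⟨
      sum (deg i)                       ≡⟨ +-identityʳ _ ⟨
      sum (deg i) + 0                   ≡⟨ cong (sum (deg i) +_) no-light ⟨
      sum (deg i) + lightIn i           ≡⟨ degrees-split i ⟩
      16 + heavyIn i                    ≡⟨ cong (16 +_) (heavyIn-3 dj) ⟩
      19                                ∎

  common : Fin 8 → Fin 8 → ℕ
  common j k = sum (λ i → agree i j k)

  close : Fin 8 → Fin 8 → ℕ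
  close j k = 𝟙 (2 ≤? common j k)

  closeCount heavyOn lightOn : Fin 8 → ℕ
  closeCount j = sum (close j)
  heavyOn    j = sum (λ i → heavy i j)
  lightOn    j = sum (λ i → light i j)

  common-self : ∀ j → common j j ≡ 6
  common-self j = sum-cong-≗ (λ i → agree-self i j)

  common-sym : ∀ j k → common j k ≡ common k j
  common-sym j k = sum-cong-≗ (λ i → agree-sym i j k)

  common≥1+close : ∀ j k → 1 + close j k ≤ common j k
  common≥1+close j k with 2 ≤? common j k
  ... | yes two = two
  ... | no  _   with intersecting j k
  ...   | (i , x) , x∈j , x∈k =
          subst (_≤ common j k) (𝟙-yes ((i , E j i) ∈? E k) (trans x∈k (sym x∈j))) (sum-point (λ i → agree i j k) i)

  close-self : ∀ j → close j j ≡ 1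
  close-self j = 𝟙-yes (2 ≤? common j j) (subst (2 ≤_) (sym (common-self j)) (s≤s (s≤s z≤n)))

  -- Counting the incidences of edge j in two ways: Σ_i deg i j = Σ_k common j k,
  -- where common j k ≥ 1 + close j k for every k and common j j = 6, while
  -- Σ_i deg i j = 12 + heavyOn j - lightOn j by deg-split.
  edge-balance : ∀ j → closeCount j + lightOn j ≤ heavyOn j
  edge-balance j = +-cancelˡ-≤ 12 _ _ (begin
    12 + (closeCount j + lightOn j)                ≡⟨ regroup (closeCount j) (lightOn j) ⟩
    4 + (8 + closeCount j) + lightOn j             ≡⟨ cong (λ c → 4 + c + lightOn j) (∑-distrib-+ (λ _ → 1) (close j)) ⟨
    4 + sum (λ k → 1 + close j k) + lightOn j      ≤⟨ +-monoˡ-≤ (lightOn j) by-commons ⟩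
    sum (common j) + lightOn j                    ≡⟨ cong (_+ lightOn j) (∑-comm (λ i k → agree i j k)) ⟨
    sum (λ i → sum (agree i j)) + lightOn j        ≡⟨ cong (_+ lightOn j) (sum-cong-≗ (λ i → deg-agree i j)) ⟨
    sum (λ i → deg i j) + lightOn j                ≡⟨ ∑-distrib-+ (λ i → deg i j) (λ i → light i j) ⟨
    sum (λ i → deg i j + light i j)                ≡⟨ sum-cong-≗ (λ i → deg-split i j) ⟩
    sum (λ i → 2 + heavy i j)                      ≡⟨ ∑-distrib-+ (λ _ → 2) (λ i → heavy i j) ⟩
    12 + heavyOn j                                 ∎)
    where
    open ≤-Reasoning
    regroup : ∀ c l → 12 + (c + l) ≡ 4 + (8 + c) + l
    regroup = solve-∀
    by-commons : 4 + sum (λ k → 1 + close j k) ≤ sum (common j)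
    by-commons = sum-bump j {4} (common≥1+close j)
                 (subst₂ (λ c o → 4 + (1 + c) ≤ o) (sym (close-self j)) (sym (common-self j)) ≤-refl)

  closeCount-pos : ∀ j → 1 ≤ closeCount j
  closeCount-pos j = subst (_≤ closeCount j) (close-self j) (sum-point (close j) j)

  heavyOn-pos : ∀ j → 1 ≤ heavyOn j
  heavyOn-pos j = ≤-trans (closeCount-pos j) (≤-trans (m≤m+n _ _) (edge-balance j))

  K : ℕ
  K = sum hasHeavy

  K≤6 : K ≤ 6
  K≤6 = sum-mono (λ i → 𝟙≤1 (hasHeavy? i))

  heavy-total : sum heavyOn ≡ 3 * K
  heavy-total = begin
    sum (λ j → sum (λ i → heavy i j))   ≡⟨ ∑-comm heavy ⟨
    sum heavyIn                         ≡⟨ sum-cong-≗ heavyIn-hasHeavy ⟩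
    sum (λ i → 3 * hasHeavy i)          ≡⟨ *-distribˡ-sum 3 hasHeavy ⟨
    3 * K                               ∎
    where open ≡-Reasoning

  coHeavy : Fin 6 → Fin 6 → ℕ
  coHeavy i i′ = sum (λ k → heavy i k * heavy i′ k)

  coHeavy-self : ∀ i → coHeavy i i ≡ heavyIn i
  coHeavy-self i = sum-cong-≗ (λ k → 𝟙-idem (deg i k ≟ 3))

  coHeavy-sym : ∀ i i′ → coHeavy i i′ ≡ coHeavy i′ i
  coHeavy-sym i i′ = sum-cong-≗ (λ k → *-comm (heavy i k) (heavy i′ k))

  sum-squares : sum (λ j → heavyOn j * heavyOn j) ≡ sum (λ i → sum (coHeavy i))
  sum-squares = begin
    sum (λ j → heavyOn j * heavyOn j)                                ≡⟨ sum-cong-≗ expand ⟩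
    sum (λ j → sum (λ i → sum (λ i′ → heavy i j * heavy i′ j)))      ≡⟨ ∑-comm (λ j i → sum (λ i′ → heavy i j * heavy i′ j)) ⟩
    sum (λ i → sum (λ j → sum (λ i′ → heavy i j * heavy i′ j)))      ≡⟨ sum-cong-≗ (λ i → ∑-comm (λ j i′ → heavy i j * heavy i′ j)) ⟩
    sum (λ i → sum (coHeavy i))                                      ∎
    where
    open ≡-Reasoning
    expand : ∀ j → heavyOn j * heavyOn j ≡ sum (λ i → sum (λ i′ → heavy i j * heavy i′ j))
    expand j = trans (*-distribʳ-sum (heavyOn j) (λ i → heavy i j))
                     (sum-cong-≗ (λ i → *-distribˡ-sum (heavy i j) (λ i′ → heavy i′ j)))

  -- Any two heavy vertices lie on a common edge.
  coHeavy-lower : ∀ {i j} → deg i j ≡ 3 → ∀ i′ → hasHeavy i′ ≤ coHeavy i i′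
  coHeavy-lower {i} {j} dj i′ with hasHeavy? i′
  ... | no  _          = z≤n
  ... | yes (j′ , dj′)
      with degree3-meet (i , E j i) (i′ , E j′ i′) (trans (deg-degree i j) dj) (trans (deg-degree i′ j′) dj′)
  ...   | k , j∈k , j′∈k =
          subst (_≤ coHeavy i i′)
                (𝟙-both-yes (deg i k ≟ 3) (deg i′ k ≟ 3) (trans (deg-class j∈k) dj) (trans (deg-class j′∈k) dj′))
                (sum-point (λ k → heavy i k * heavy i′ k) k)

  diagonal-gain : ∀ {i j} → deg i j ≡ 3 → 2 + hasHeavy i ≤ coHeavy i i
  diagonal-gain {i} dj = ≤-trans (+-monoʳ-≤ 2 (𝟙≤1 (hasHeavy? i)))
                                 (≤-reflexive (sym (trans (coHeavy-self i) (heavyIn-3 dj))))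

  row-lower : ∀ i → hasHeavy i * (2 + K) ≤ sum (coHeavy i)
  row-lower i = by-cases (hasHeavy? i)
    where
    by-cases : (d : Dec (HasHeavy i)) → 𝟙 d * (2 + K) ≤ sum (coHeavy i)
    by-cases (no  _)        = z≤n
    by-cases (yes (j , dj)) = subst (_≤ sum (coHeavy i)) (sym (+-identityʳ (2 + K)))
                                    (sum-bump i (coHeavy-lower dj) (diagonal-gain dj))

  squares-lower : K * (2 + K) ≤ sum (λ j → heavyOn j * heavyOn j)
  squares-lower = begin
    K * (2 + K)                          ≡⟨ *-distribʳ-sum (2 + K) hasHeavy ⟩
    sum (λ i → hasHeavy i * (2 + K))     ≤⟨ sum-mono row-lower ⟩
    sum (λ i → sum (coHeavy i))          ≡⟨ sum-squares ⟨
    sum (λ j → heavyOn j * heavyOn j)    ∎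
    where open ≤-Reasoning

  coHeavy-two : ∀ {i i′ j k} → j ≢ k → deg i j ≡ 3 → deg i′ j ≡ 3 → deg i k ≡ 3 → deg i′ k ≡ 3 →
                2 ≤ coHeavy i i′
  coHeavy-two {i} {i′} {j} {k} j≢k dij di′j dik di′k =
    subst (_≤ coHeavy i i′) (cong₂ _+_ (𝟙-both-yes (deg i j ≟ 3) (deg i′ j ≟ 3) dij di′j)
                                       (𝟙-both-yes (deg i k ≟ 3) (deg i′ k ≟ 3) dik di′k))
          (sum-two (λ l → heavy i l * heavy i′ l) j≢k)

  record DoublePair : Set where
    field
      i₁ i₂ : Fin 6
      a b   : Fin 8
      i₁≢i₂ : i₁ ≢ i₂
      a≢b   : a ≢ b
      deg₁  : deg i₁ a ≡ 3
      deg₂  : deg i₂ a ≡ 3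
      b∋₁   : E b i₁ ≡ E a i₁
      b∋₂   : E b i₂ ≡ E a i₂

  module _ (pair : DoublePair) where
    open DoublePair pair

    coHeavy≥2 : 2 ≤ coHeavy i₁ i₂
    coHeavy≥2 = coHeavy-two a≢b deg₁ deg₂ (trans (deg-class b∋₁) deg₁) (trans (deg-class b∋₂) deg₂)

    row-strict : ∀ {i i′ j} → i ≢ i′ → deg i j ≡ 3 → 2 ≤ coHeavy i i′ → 1 + hasHeavy i * (2 + K) ≤ sum (coHeavy i)
    row-strict {i} {i′} {j} i≢i′ dj two = subst (_≤ sum (coHeavy i)) shape
      (sum-bump₂ i≢i′ (coHeavy-lower dj) (diagonal-gain dj) (≤-trans (+-monoʳ-≤ 1 (𝟙≤1 (hasHeavy? i′))) two))
      where
      shape : 2 + 1 + K ≡ 1 + hasHeavy i * (2 + K)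
      shape = trans (cong (1 +_) (sym (+-identityʳ (2 + K))))
                    (cong (λ h → 1 + h * (2 + K)) (sym (𝟙-yes (hasHeavy? i) (j , dj))))

    squares-lower-strict : 2 + K * (2 + K) ≤ sum (λ j → heavyOn j * heavyOn j)
    squares-lower-strict = begin
      2 + K * (2 + K)                        ≡⟨ cong (2 +_) (*-distribʳ-sum (2 + K) hasHeavy) ⟩
      1 + 1 + sum (λ i → hasHeavy i * (2 + K))
        ≤⟨ sum-bump₂ i₁≢i₂ row-lower (row-strict i₁≢i₂ deg₁ coHeavy≥2)
                                      (row-strict (i₁≢i₂ ∘ sym) deg₂ (subst (2 ≤_) (coHeavy-sym i₁ i₂) coHeavy≥2)) ⟩
      sum (λ i → sum (coHeavy i))            ≡⟨ sum-squares ⟨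
      sum (λ j → heavyOn j * heavyOn j)      ∎
      where open ≤-Reasoning

  module Linear (linear : ∀ i i′ → i ≢ i′ → coHeavy i i′ ≤ 1) where

    shared : Fin 8 → Fin 8 → ℕ
    shared j k = sum (λ i → heavy i j * heavy i k)

    shared-self : ∀ j → shared j j ≡ heavyOn j
    shared-self j = sum-cong-≗ (λ i → 𝟙-idem (deg i j ≟ 3))

    shared-total : ∀ j → sum (shared j) ≡ 3 * heavyOn j
    shared-total j = begin
      sum (λ k → sum (λ i → heavy i j * heavy i k))  ≡⟨ ∑-comm (λ k i → heavy i j * heavy i k) ⟩
      sum (λ i → sum (λ k → heavy i j * heavy i k))  ≡⟨ sum-cong-≗ (λ i → *-distribˡ-sum (heavy i j) (heavy i)) ⟨
      sum (λ i → heavy i j * heavyIn i)             ≡⟨ sum-cong-≗ (λ i → heavy-weight i j) ⟩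
      sum (λ i → 3 * heavy i j)                      ≡⟨ *-distribˡ-sum 3 (λ i → heavy i j) ⟨
      3 * heavyOn j                                  ∎
      where open ≡-Reasoning

    shared≤1 : ∀ {j k} → j ≢ k → shared j k ≤ 1
    shared≤1 {j} {k} j≢k = ≤-pred (≰⇒> no-two)
      where
      no-two : ¬ (2 ≤ shared j k)
      no-two two = refute (sum-witness₂ (λ i → heavy i j * heavy i k) (λ i → *-mono-≤ (𝟙≤1 (deg i j ≟ 3)) (𝟙≤1 (deg i k ≟ 3))) two)
        where
        refute : ∃[ i ] ∃[ i′ ] (i ≢ i′ × 1 ≤ heavy i j * heavy i k × 1 ≤ heavy i′ j * heavy i′ k) → ⊥
        refute (i , i′ , i≢i′ , on-i , on-i′) =
          let dij , dik = 𝟙-both (deg i j ≟ 3) (deg i k ≟ 3) on-i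
              di′j , di′k = 𝟙-both (deg i′ j ≟ 3) (deg i′ k ≟ 3) on-i′
          in <⇒≱ (s≤s (linear i i′ i≢i′)) (coHeavy-two j≢k dij di′j dik di′k)

    others-total : ∀ j → sum (removeAt (shared j) j) ≡ 2 * heavyOn j
    others-total j = +-cancelˡ-≡ (heavyOn j) _ _ (begin
      heavyOn j + sum (removeAt (shared j) j)    ≡⟨ cong (_+ sum (removeAt (shared j) j)) (shared-self j) ⟨
      shared j j + sum (removeAt (shared j) j)   ≡⟨ sum-remove (shared j) ⟨
      sum (shared j)                             ≡⟨ shared-total j ⟩
      3 * heavyOn j                              ∎)
      where open ≡-Reasoning

    others≤1 : ∀ j k → removeAt (shared j) j k ≤ 1
    others≤1 j k = shared≤1 (Fin.punchInᵢ≢i j k ∘ sym)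

    heavyOn≤3 : ∀ j → heavyOn j ≤ 3
    heavyOn≤3 j = half-of-seven (heavyOn j)
      (subst (_≤ 7) (others-total j) (≤-trans (sum-mono (others≤1 j)) (≤-reflexive (sum-const {7} 1))))

    missing-edge : ∀ j → heavyOn j ≡ 3 → ∃[ u ] shared j u ≡ 0
    missing-edge j three with Fin.any? (λ k → removeAt (shared j) j k ≟ 0)
    ... | yes (k , none) = punchIn j k , none
    ... | no  all-met    = contradiction (≤-trans (sum-mono met) (≤-reflexive (trans (others-total j) (cong (2 *_) three))))
                                         (from-no (7 ≤? 6))
      where
      met : ∀ k → 1 ≤ removeAt (shared j) j k
      met k = n≢0⇒n>0 (λ none → all-met (k , none))

    -- If edge u has no heavy vertex in common with edge j, let w be a heavy
    -- vertex on u, in part p.  Each heavy vertex of j shares an edge with w;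
    -- these edges are distinct and differ from j and u, so heavyOn j ≤ deg w - 1.
    disjoint-edge-at : ∀ {j u p} → shared j u ≡ 0 → deg p u ≡ 3 → heavyOn j ≤ 2
    disjoint-edge-at {j} {u} {p} apart dpu = ≤-pred (begin
      1 + heavyOn j                                   ≤⟨ +-monoʳ-≤ 1 (sum-mono reach) ⟩
      1 + sum (λ i → heavy i j * coHeavy p i)         ≡⟨ cong (1 +_) through ⟨
      1 + sum (λ k → heavy p k * shared j k)          ≤⟨ sum-bump u term-bound gain ⟩
      heavyIn p                                       ≡⟨ heavyIn-3 dpu ⟩
      3                                               ∎)
      where
      open ≤-Reasoning
      off-j : heavy p j ≡ 0
      off-j = 𝟙-no (deg p j ≟ 3) (λ dpj → contradiction
                (subst (_≤ shared j u) (𝟙-both-yes (deg p j ≟ 3) (deg p u ≟ 3) dpj dpu)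
                       (sum-point (λ i → heavy i j * heavy i u) p))
                (subst (λ s → ¬ (1 ≤ s)) (sym apart) λ ()))
      reach : ∀ i → heavy i j ≤ heavy i j * coHeavy p i
      reach i = by-cases (deg i j ≟ 3)
        where
        by-cases : (d : Dec (deg i j ≡ 3)) → 𝟙 d ≤ 𝟙 d * coHeavy p i
        by-cases (no  _)  = z≤n
        by-cases (yes dj) = subst (_≤ 1 * coHeavy p i) (𝟙-yes (hasHeavy? i) (j , dj))
                                  (subst (hasHeavy i ≤_) (sym (*-identityˡ (coHeavy p i))) (coHeavy-lower dpu i))
      through : sum (λ k → heavy p k * shared j k) ≡ sum (λ i → heavy i j * coHeavy p i)
      through = begin-equality
        sum (λ k → heavy p k * shared j k)
          ≡⟨ sum-cong-≗ (λ k → *-distribˡ-sum (heavy p k) (λ i → heavy i j * heavy i k)) ⟩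
        sum (λ k → sum (λ i → heavy p k * (heavy i j * heavy i k)))
          ≡⟨ sum-cong-≗ (λ k → sum-cong-≗ (λ i → swap (heavy p k) (heavy i j) (heavy i k))) ⟩
        sum (λ k → sum (λ i → heavy i j * (heavy p k * heavy i k)))
          ≡⟨ ∑-comm (λ k i → heavy i j * (heavy p k * heavy i k)) ⟩
        sum (λ i → sum (λ k → heavy i j * (heavy p k * heavy i k)))
          ≡⟨ sum-cong-≗ (λ i → *-distribˡ-sum (heavy i j) (λ k → heavy p k * heavy i k)) ⟨
        sum (λ i → heavy i j * coHeavy p i)
          ∎
        where
        swap : ∀ x y z → x * (y * z) ≡ y * (x * z)
        swap = solve-∀
      term-bound : ∀ k → heavy p k * shared j k ≤ heavy p k
      term-bound k = by-cases (k Fin.≟ j)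
        where
        by-cases : Dec (k ≡ j) → heavy p k * shared j k ≤ heavy p k
        by-cases (yes refl) = ≤-reflexive (trans (cong (_* shared j j) off-j) (sym off-j))
        by-cases (no  k≢j)  = ≤-trans (*-monoʳ-≤ (heavy p k) (shared≤1 (k≢j ∘ sym))) (≤-reflexive (*-identityʳ (heavy p k)))
      gain : 1 + heavy p u * shared j u ≤ heavy p u
      gain = subst₂ (λ h s → 1 + h * s ≤ h) (sym (𝟙-yes (deg p u ≟ 3) dpu)) (sym apart) ≤-refl

    disjoint-edge : ∀ j u → shared j u ≡ 0 → heavyOn j ≤ 2
    disjoint-edge j u apart =
      let p , on-p = sum-witness (λ i → heavy i u) (heavyOn-pos u)
      in disjoint-edge-at apart (𝟙-sound (deg p u ≟ 3) on-p)

    heavyOn≤2 : ∀ j → heavyOn j ≤ 2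
    heavyOn≤2 j = by-cases (m≤n⇒m<n∨m≡n (heavyOn≤3 j))
      where
      by-cases : heavyOn j < 3 ⊎ heavyOn j ≡ 3 → heavyOn j ≤ 2
      by-cases (inj₁ below) = ≤-pred below
      by-cases (inj₂ three) = let u , apart = missing-edge j three in disjoint-edge j u apart

    impossible : ⊥
    impossible = no-linear-count K K≤6 (begin
      K * (2 + K) + 16                          ≤⟨ +-monoˡ-≤ 16 squares-lower ⟩
      sum (λ j → heavyOn j * heavyOn j) + 16    ≡⟨ ∑-distrib-+ (λ j → heavyOn j * heavyOn j) (λ _ → 2) ⟨
      sum (λ j → heavyOn j * heavyOn j + 2)     ≤⟨ sum-mono (λ j → square-bound₂ (heavyOn j) (heavyOn-pos j) (heavyOn≤2 j)) ⟩
      sum (λ j → 3 * heavyOn j)                 ≡⟨ *-distribˡ-sum 3 heavyOn ⟨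
      3 * sum heavyOn                           ≡⟨ cong (3 *_) heavy-total ⟩
      3 * (3 * K)                               ≡⟨ *-assoc 3 3 K ⟨
      9 * K                                     ∎)
      where open ≤-Reasoning

  double-pair : DoublePair
  double-pair = from-decision (Fin.any? (λ i → Fin.any? (λ i′ → ¬? (i Fin.≟ i′) ×-dec (2 ≤? coHeavy i i′))))
    where
    from-decision : Dec (∃[ i ] ∃[ i′ ] (i ≢ i′ × 2 ≤ coHeavy i i′)) → DoublePair
    from-decision (no none) =
      ⊥-elim (Linear.impossible (λ i i′ i≢i′ → ≤-pred (≰⇒> (λ two → none (i , i′ , i≢i′ , two)))))
    from-decision (yes (i , i′ , i≢i′ , two)) =
      build (sum-witness₂ (λ k → heavy i k * heavy i′ k) (λ k → *-mono-≤ (𝟙≤1 (deg i k ≟ 3)) (𝟙≤1 (deg i′ k ≟ 3))) two)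
      where
      build : ∃[ a ] ∃[ b ] (a ≢ b × 1 ≤ heavy i a * heavy i′ a × 1 ≤ heavy i b * heavy i′ b) → DoublePair
      build (a , b , a≢b , on-a , on-b) =
        let dia , di′a = 𝟙-both (deg i a ≟ 3) (deg i′ a ≟ 3) on-a
            dib , di′b = 𝟙-both (deg i b ≟ 3) (deg i′ b ≟ 3) on-b
        in record { i₁ = i ; i₂ = i′ ; a = a ; b = b ; i₁≢i₂ = i≢i′ ; a≢b = a≢b ; deg₁ = dia ; deg₂ = di′a
                  ; b∋₁ = heavy-unique dia dib ; b∋₂ = heavy-unique di′a di′b }

  -- A part without heavy vertex is impossible: K would be 5, the counts of
  -- edge-balance would be tight, forcing heavyOn j ≤ 3, and then
  -- 37 = 2 + K(K + 2) ≤ Σ heavyOn² ≤ 4 Σ heavyOn - 24 = 36.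
  module MissingPart (pair : DoublePair) (i₀ : Fin 6) (none : ¬ HasHeavy i₀) where
    open DoublePair pair

    K≤5 : K ≤ 5
    K≤5 = ≤-pred (sum-bump i₀ {1} (λ i → 𝟙≤1 (hasHeavy? i))
                    (≤-reflexive (cong suc (𝟙-no (hasHeavy? i₀) none))))

    -- Edges a and b are close to each other, so at least 10 close pairs are counted.
    common-ab : 2 ≤ common a b
    common-ab = subst (_≤ common a b)
      (cong₂ _+_ (𝟙-yes ((i₁ , E a i₁) ∈? E b) b∋₁) (𝟙-yes ((i₂ , E a i₂) ∈? E b) b∋₂))
      (sum-two (λ i → agree i a b) i₁≢i₂)

    close-ab : close a b ≡ 1
    close-ab = 𝟙-yes (2 ≤? common a b) common-ab

    close-ba : close b a ≡ 1
    close-ba = 𝟙-yes (2 ≤? common b a) (subst (2 ≤_) (common-sym a b) common-ab)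

    closeFloor : Fin 8 → ℕ
    closeFloor k = 1 + 𝟙 (k Fin.≟ a) + 𝟙 (k Fin.≟ b)

    closeFloor-total : sum closeFloor ≡ 10
    closeFloor-total = trans (∑-distrib-+ (λ k → 1 + 𝟙 (k Fin.≟ a)) (λ k → 𝟙 (k Fin.≟ b)))
      (cong₂ _+_ (trans (∑-distrib-+ (λ _ → 1) (λ k → 𝟙 (k Fin.≟ a))) (cong (8 +_) (sum-point-mass a)))
                 (sum-point-mass b))

    closeFloor≤closeCount : ∀ k → closeFloor k ≤ closeCount k
    closeFloor≤closeCount k = by-cases (k Fin.≟ a) (k Fin.≟ b)
      where
      by-cases : (ka : Dec (k ≡ a)) (kb : Dec (k ≡ b)) → 1 + 𝟙 ka + 𝟙 kb ≤ closeCount k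
      by-cases (yes refl) (yes refl) = contradiction refl a≢b
      by-cases (yes refl) (no  _)    = subst (_≤ closeCount a) (cong₂ _+_ (close-self a) close-ab) (sum-two (close a) a≢b)
      by-cases (no  _)    (yes refl) = subst (_≤ closeCount b) (cong₂ _+_ (close-self b) close-ba) (sum-two (close b) (a≢b ∘ sym))
      by-cases (no  _)    (no  _)    = closeCount-pos k

    closeFloor≤2 : ∀ k → closeFloor k ≤ 2
    closeFloor≤2 k = by-cases (k Fin.≟ a) (k Fin.≟ b)
      where
      by-cases : (ka : Dec (k ≡ a)) (kb : Dec (k ≡ b)) → 1 + 𝟙 ka + 𝟙 kb ≤ 2
      by-cases (yes refl) (yes refl) = contradiction refl a≢b
      by-cases (yes _)    (no  _)    = ≤-refl
      by-cases (no  _)    (yes _)    = ≤-refl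
      by-cases (no  _)    (no  _)    = s≤s z≤n

    closeCount-total : 10 ≤ sum closeCount
    closeCount-total = subst (_≤ sum closeCount) closeFloor-total (sum-mono closeFloor≤closeCount)

    budget : sum closeCount + sum lightOn ≤ 3 * K
    budget = subst₂ _≤_ (∑-distrib-+ closeCount lightOn) heavy-total (sum-mono edge-balance)

    -- Every part with a heavy vertex has a light one (parity), and so may part i₀.
    lights : lightIn i₀ + K ≤ sum lightOn
    lights = subst (lightIn i₀ + K ≤_) (∑-comm light)
      (sum-bump i₀ light-where-heavy
        (≤-reflexive (trans (cong (lightIn i₀ +_) (𝟙-no (hasHeavy? i₀) none)) (+-identityʳ _))))

    forced : K ≡ 5 × lightIn i₀ ≡ 0
    forced = forced-five K (lightIn i₀) K≤5 (begin
      10 + K + lightIn i₀                  ≡⟨ regroup K (lightIn i₀) ⟩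
      10 + (lightIn i₀ + K)                ≤⟨ +-mono-≤ closeCount-total lights ⟩
      sum closeCount + sum lightOn         ≤⟨ budget ⟩
      3 * K                                ∎)
      where
      open ≤-Reasoning
      regroup : ∀ k l → 10 + k + l ≡ 10 + (l + k)
      regroup = solve-∀

    lightOn-total : 5 ≤ sum lightOn
    lightOn-total = ≤-trans (m≤n+m 5 (lightIn i₀)) (subst (λ k → lightIn i₀ + k ≤ sum lightOn) (proj₁ forced) lights)

    budget-5 : sum closeCount + sum lightOn ≤ 15
    budget-5 = subst (λ k → sum closeCount + sum lightOn ≤ 3 * k) (proj₁ forced) budget

    -- The count of close pairs is tight: every edge is close to at most one other edge.
    closeCount≤2 : ∀ j → closeCount j ≤ 2
    closeCount≤2 j = ≤-trans (sum-tight closeFloor≤closeCount total j) (closeFloor≤2 j)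
      where
      total : sum closeCount ≤ sum closeFloor
      total = subst (sum closeCount ≤_) (sym closeFloor-total)
                (+-cancelʳ-≤ 5 _ _ (≤-trans (+-monoʳ-≤ (sum closeCount) lightOn-total) budget-5))

    balance-tight : ∀ j → heavyOn j ≤ closeCount j + lightOn j
    balance-tight = sum-tight edge-balance (begin
      sum heavyOn                            ≡⟨ trans heavy-total (cong (3 *_) (proj₁ forced)) ⟩
      15                                     ≤⟨ +-mono-≤ closeCount-total lightOn-total ⟩
      sum closeCount + sum lightOn           ≡⟨ ∑-distrib-+ closeCount lightOn ⟨
      sum (λ j → closeCount j + lightOn j)   ∎)
      where open ≤-Reasoning

    -- Part i₀ has neither heavy nor light vertices.
    heavy+light-on : ∀ j → heavyOn j + lightOn j ≤ 5
    heavy+light-on j = ≤-pred (subst (λ s → 1 + s ≤ 6) (∑-distrib-+ (λ i → heavy i j) (λ i → light i j))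
      (sum-bump i₀ {1} (λ i → heavy+light≤1 i j) (≤-reflexive (cong suc (cong₂ _+_ no-heavy no-light)))))
      where
      no-heavy : heavy i₀ j ≡ 0
      no-heavy = 𝟙-no (deg i₀ j ≟ 3) (λ d → none (j , d))
      no-light : light i₀ j ≡ 0
      no-light = n≤0⇒n≡0 (subst (light i₀ j ≤_) (proj₂ forced) (sum-point (light i₀) j))

    heavyOn≤3 : ∀ j → heavyOn j ≤ 3
    heavyOn≤3 j = half-of-seven r (begin
      2 * r                  ≡⟨ cong (r +_) (+-identityʳ r) ⟩
      r + r                  ≤⟨ +-monoʳ-≤ r (≤-trans (balance-tight j) (+-monoˡ-≤ (lightOn j) (closeCount≤2 j))) ⟩
      r + (2 + lightOn j)    ≡⟨ regroup r (lightOn j) ⟩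
      2 + (r + lightOn j)    ≤⟨ +-monoʳ-≤ 2 (heavy+light-on j) ⟩
      7                      ∎)
      where
      open ≤-Reasoning
      r = heavyOn j
      regroup : ∀ r l → r + (2 + l) ≡ 2 + (r + l)
      regroup = solve-∀

    impossible : ⊥
    impossible = from-no (61 ≤? 60) (subst (λ k → 2 + k * (2 + k) + 24 ≤ 4 * (3 * k)) (proj₁ forced) (begin
      2 + K * (2 + K) + 24                      ≤⟨ +-monoˡ-≤ 24 (squares-lower-strict pair) ⟩
      sum (λ j → heavyOn j * heavyOn j) + 24    ≡⟨ ∑-distrib-+ (λ j → heavyOn j * heavyOn j) (λ _ → 3) ⟨
      sum (λ j → heavyOn j * heavyOn j + 3)     ≤⟨ sum-mono (λ j → square-bound₃ (heavyOn j) (heavyOn-pos j) (heavyOn≤3 j)) ⟩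
      sum (λ j → 4 * heavyOn j)                 ≡⟨ *-distribˡ-sum 4 heavyOn ⟨
      4 * sum heavyOn                           ≡⟨ cong (4 *_) heavy-total ⟩
      4 * (3 * K)                               ∎))
      where open ≤-Reasoning

  every-part-heavy : ∀ i → HasHeavy i
  every-part-heavy i = decidable-stable (hasHeavy? i) (MissingPart.impossible double-pair i)

lemma1 : (H : Hypergraph6 8) → Intersecting H → TauEq H 4 →
    ((i : Fin 6) → ∃[ x ] (degree H (i , x) ≡ 3))
    × (∃[ j ] ∃[ k ] (j ≢ k × ∃[ v ] ∃[ w ] (v ≢ w
        × v ∈ₑ edge H j × v ∈ₑ edge H k
        × w ∈ₑ edge H j × w ∈ₑ edge H k
        × degree H v ≡ 3 × degree H w ≡ 3)))
lemma1 H intersecting (_ , τ≥4) = every-part , two-edges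
  where
  open Covers H using (degree-bound; codegree-bound)

  -- degree + 8 ≤ 11, and two degree-3 vertices apart would give 14 ≤ 13.
  degree≤3 : ∀ v → degree H v ≤ 3
  degree≤3 v = +-cancelʳ-≤ 8 _ 3 (degree-bound intersecting τ≥4 v)

  degree3-meet : ∀ v w → degree H v ≡ 3 → degree H w ≡ 3 → ∃[ k ] (v ∈ₑ edge H k × w ∈ₑ edge H k)
  degree3-meet v w dv dw = decidable-stable (Fin.any? (λ k → (v ∈? edge H k) ×-dec (w ∈? edge H k)))
    (λ apart → from-no (14 ≤? 13) (subst₂ (λ x y → x + y + 8 ≤ 13) dv dw
                 (codegree-bound intersecting τ≥4 v w (λ k both → apart (k , both)))))

  open Core H intersecting degree≤3 degree3-meet

  every-part : (i : Fin 6) → ∃[ x ] (degree H (i , x) ≡ 3)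
  every-part i = let j , dj = every-part-heavy i in E j i , trans (deg-degree i j) dj

  open DoublePair double-pair

  two-edges : ∃[ j ] ∃[ k ] (j ≢ k × ∃[ v ] ∃[ w ] (v ≢ w
                × v ∈ₑ edge H j × v ∈ₑ edge H k
                × w ∈ₑ edge H j × w ∈ₑ edge H k
                × degree H v ≡ 3 × degree H w ≡ 3))
  two-edges = a , b , a≢b , (i₁ , E a i₁) , (i₂ , E a i₂) , i₁≢i₂ ∘ cong proj₁
            , refl , b∋₁ , refl , b∋₂ , trans (deg-degree i₁ a) deg₁ , trans (deg-degree i₂ a) deg₂
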